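{- For every 3CNF formula $\phi$, $\phi$ is satisfiable if and only if the timed automaton $\mathcal{A}^{NZ}_\phi$ has a non-Zeno run.
   Context: Timed automata and runs: Let $X$ be a finite set of clocks; a valuation is $v:X\to\mathbb{R}_{\ge0}$, $v+\delta$ adds $\delta$ to every clock, $[R]v$ resets the clocks in $R$ to $0$. A timed automaton $\mathcal A=(Q,q_0,X,T)$ has finite state set $Q$, initial state $q_0$ and finite set of transitions $(q,g,R,q')$ with guard $g$ (a conjunction of constraints $x\#c$, $\#\in\{<,\le,=,\ge,>\}$, $c\in\mathbb N$) and reset set $R\subseteq X$. A run is a sequence $(q_0,v_0)\xrightarrow{\delta_0,t_0}(q_1,v_1)\xrightarrow{\delta_1,t_1}\cdots$ with $v_0=\mathbf 0$, where from $(q_i,v_i)$ one lets $\delta_i\ge0$ time elapse and then takes $t_i=(q_i,g,R,q_{i+1})$, which requires $v_i+\delta_i\models g$, and $v_{i+1}=[R](v_i+\delta_i)$. An infinite run is Zeno if $\sum_i\delta_i$ is finite and non-Zeno otherwise. The automaton $\mathcal A^{NZ}_\phi$: let $P=\{p_1,\dots,p_k\}$ be the propositional variables and $\phi=C_1\wedge\dots\wedge C_n$ with each clause $C_m=\ell^m_1\vee\ell^m_2\vee\ell^m_3$ a disjunction of three literals. The clocks are $\{x_1,\bar{x}_1,\dots,x_k,\bar{x}_k\}$; for a literal $\ell$, $cl(\ell)=x_i$ if $\ell=p_i$ and $cl(\ell)=\bar{x}_i$ if $\ell=\neg p_i$. States are $q_0,\dots,q_k,r_0,\dots,r_n$, initial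 state $q_0$. Transitions: for each $i\in\{1,\dots,k\}$, a transition $q_{i-1}\to q_i$ with no guard resetting $\{x_i\}$ and one with no guard resetting $\{\bar x_i\}$; for each $m\in\{1,\dots,n\}$ and each $\ell\in\{\ell^m_1,\ell^m_2,\ell^m_3\}$, a transition $r_{m-1}\to r_m$ with guard $cl(\ell)\le 0$ and no reset; a transition $q_k\to r_0$ and a transition $r_n\to q_0$, both without guard or reset.
   Formalization: Runs have rational clock valuations and non-negative rational delays instead of values in $\mathbb{R}_{\ge0}$. -}

module Defs where

open import Data.Nat using (ℕ; zero; suc)
open import Data.Fin using (Fin; zero; suc; inject₁; fromℕ)
open import Data.Bool using (Bool; true; false; not)
open import Data.Vec using (Vec; toList)
import Data.Vec as Vec
open import Data.List using (List; []; _∷_; _++_; concatMap; map)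
import Data.List as List
open import Data.List.Membership.Propositional using (_∈_; _∉_)
open import Data.List.Relation.Unary.All using (All)
open import Data.List.Relation.Unary.Any using (Any)
open import Data.Product using (Σ; ∃; _×_; _,_; proj₁; proj₂)
open import Data.Integer using (+_)
open import Data.Rational using (ℚ; 0ℚ; _+_; _≤_; _<_; _/_)
open import Relation.Binary.PropositionalEquality using (_≡_)
open import Relation.Nullary using (¬_)
import Data.Vec.Relation.Unary.All as VAll
import Data.Vec.Relation.Unary.Any as VAny
open import Data.List using (allFin)

data Cmp : Set where
  lt le eq ge gt : Cmp

record Constraint (C : Set) : Set where
  constructor _∶_∶_
  field
    clock : C
    cmp   : Cmp
    const : ℕ

Guard : Set → Set
Guard C = List (Constraint C)

Valuation : Set → Set
Valuation C = C → ℚ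

ℕ→ℚ : ℕ → ℚ
ℕ→ℚ c = + c / 1

_⊨c_ : {C : Set} → Valuation C → Constraint C → Set
v ⊨c (x ∶ lt ∶ c) = v x < ℕ→ℚ c
v ⊨c (x ∶ le ∶ c) = v x ≤ ℕ→ℚ c
v ⊨c (x ∶ eq ∶ c) = v x ≡ ℕ→ℚ c
v ⊨c (x ∶ ge ∶ c) = ℕ→ℚ c ≤ v x
v ⊨c (x ∶ gt ∶ c) = ℕ→ℚ c < v x

_⊨_ : {C : Set} → Valuation C → Guard C → Set
v ⊨ g = All (v ⊨c_) g

_⊕_ : {C : Set} → Valuation C → ℚ → Valuation C
(v ⊕ δ) x = v x + δ

record Transition (Q C : Set) : Set where
  constructor tr
  field
    src   : Q
    guard : Guard C
    reset : List C
    tgt   : Q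

record TA : Set₁ where
  field
    Q      : Set
    q₀     : Q
    C      : Set
    clocks : List C
    trans  : List (Transition Q C)

record Run (A : TA) : Set where
  open TA A
  field
    st    : ℕ → Q
    val   : ℕ → Valuation C
    delay : ℕ → ℚ
    step  : ℕ → Transition Q C
    st₀   : st 0 ≡ q₀
    val₀  : ∀ x → val 0 x ≡ 0ℚ
    delay≥0 : ∀ i → 0ℚ ≤ delay i
    step∈ : ∀ i → step i ∈ trans
    src≡  : ∀ i → Transition.src (step i) ≡ st i
    tgt≡  : ∀ i → Transition.tgt (step i) ≡ st (suc i)
    guard-ok : ∀ i → (val i ⊕ delay i) ⊨ Transition.guard (step i)
    reset-in  : ∀ i x → x ∈ Transition.reset (step i) → val (suc i) x ≡ 0ℚ
    reset-out : ∀ i x → x ∉ Transition.reset (step i) →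
                val (suc i) x ≡ (val i ⊕ delay i) x

elapsed : (ℕ → ℚ) → ℕ → ℚ
elapsed d zero    = 0ℚ
elapsed d (suc n) = elapsed d n + d n

-- Zeno: Σ δᵢ finite, i.e. the (monotone) partial sums are bounded
Zeno : {A : TA} → Run A → Set
Zeno ρ = Σ ℚ λ B → ∀ n → elapsed (Run.delay ρ) n ≤ B

NonZeno : {A : TA} → Run A → Set
NonZeno ρ = ¬ Zeno ρ

-- literal (i , true) = p_i ; (i , false) = ¬ p_i
Literal : ℕ → Set
Literal k = Fin k × Bool

Clause : ℕ → Set
Clause k = Vec (Literal k) 3

Formula : ℕ → ℕ → Set
Formula k n = Vec (Clause k) n

Assignment : ℕ → Set
Assignment k = Fin k → Bool

litTrue : ∀ {k} → Assignment k → Literal k → Set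
litTrue a (i , b) = a i ≡ b

Satisfiable : ∀ {k n} → Formula k n → Set
Satisfiable {k} φ = Σ (Assignment k) λ a →
  VAll.All (λ cl → VAny.Any (litTrue a) cl) φ

data NZState (k n : ℕ) : Set where
  q : Fin (suc k) → NZState k n
  r : Fin (suc n) → NZState k n

-- clocks x_i = (i , true), x̄_i = (i , false)
NZClock : ℕ → Set
NZClock k = Fin k × Bool

cl : ∀ {k} → Literal k → NZClock k
cl (i , b) = (i , b)

qTrans : ∀ {k n} → Fin k → List (Transition (NZState k n) (NZClock k))
qTrans i = tr (q (inject₁ i)) [] ((i , true) ∷ []) (q (suc i))
         ∷ tr (q (inject₁ i)) [] ((i , false) ∷ []) (q (suc i))
         ∷ []

rTrans : ∀ {k n} → Formula k n → Fin n →
         List (Transition (NZState k n) (NZClock k))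
rTrans φ m = map (λ ℓ → tr (r (inject₁ m)) ((cl ℓ ∶ le ∶ 0) ∷ []) [] (r (suc m)))
                 (toList (Vec.lookup φ m))

NZTrans : ∀ {k n} → Formula k n → List (Transition (NZState k n) (NZClock k))
NZTrans {k} {n} φ =
     concatMap qTrans (allFin k)
  ++ concatMap (rTrans φ) (allFin n)
  ++ tr (q (fromℕ k)) [] [] (r zero)
  ∷ tr (r (fromℕ n)) [] [] (q zero)
  ∷ []

A-NZ : ∀ {k n} → Formula k n → TA
A-NZ {k} {n} φ = record
  { Q      = NZState k n
  ; q₀     = q zero
  ; C      = NZClock k
  ; clocks = concatMap (λ i → (i , true) ∷ (i , false) ∷ []) (allFin k)
  ; trans  = NZTrans φ
  }

{-# OPTIONS --safe #-}
-- A run of A-NZ cycles through q₀ ⋯ q_k, resetting x_i or x̄_i for each i (a choice of value for p_i),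
-- and through r₀ ⋯ r_n, where leaving r_{m-1} needs a literal of C_m whose clock reads 0.  Given a
-- satisfying assignment, reset the clocks of the true literals and wait one time unit at r_n only: the
-- run is non-Zeno.  Conversely, satisfiability being decidable, it suffices that a run with a positive
-- delay yields a satisfying assignment.  After that delay every clock that is not reset is positive,
-- and up to the next visit of r₀ every variable loses at most one of its two clocks.  So at r₀ each
-- variable has a positive clock; making its literal false satisfies every clause, because the clause
-- checks that follow pass literals whose clocks read 0, and clocks only grow in the r-phase.
module Submission where

open import Defs
open import Data.Bool.Base using (Bool; true; false; not)
import Data.Bool.Properties as Bool
open import Data.Empty using (⊥; ⊥-elim)
open import Data.Fin.Base using (Fin; zero; suc; inject₁; fromℕ; toℕ)
import Data.Fin.Properties as Fin
open import Data.Fin.Induction using (<-weakInduction)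
open import Data.Fin.Relation.Unary.Top using (View; ‵fromℕ; ‵inject₁; view; view-fromℕ)
open import Data.Fin.Subset.Properties using (anySubset?)
open import Data.Integer.Base as ℤ using (+_; -[1+_])
import Data.Integer.Properties as ℤ
open import Data.List.Base using (List; []; _∷_; concatMap; allFin)
open import Data.List.Membership.Propositional using (_∈_; _∉_; find; lose)
open import Data.List.Membership.Propositional.Properties
  using (∈-++⁺ˡ; ∈-++⁺ʳ; ∈-++⁻; ∈-concatMap⁺; ∈-concatMap⁻; ∈-map⁺; ∈-map⁻; ∈-allFin)
import Data.List.Membership.DecPropositional as DecMembership
open import Data.List.Relation.Unary.All using ([]; _∷_)
open import Data.List.Relation.Unary.Any using (here; there; satisfied)
open import Data.List.Relation.Unary.Any.Properties using (¬Any[])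
open import Data.Nat.Base as ℕ using (ℕ; zero; suc; _+_; _∸_)
import Data.Nat.Properties as ℕ
open import Data.Product.Base using (Σ; ∃-syntax; _×_; _,_; proj₁; proj₂)
open import Data.Product.Properties using (≡-dec)
open import Data.Rational.Base as ℚ using (ℚ; 0ℚ; 1ℚ; _≤_; _<_; toℚᵘ; mkℚ)
import Data.Rational.Properties as ℚ
import Data.Rational.Unnormalised.Base as ℚᵘ
import Data.Rational.Unnormalised.Properties as ℚᵘ
open import Data.Sum.Base using (inj₁; inj₂)
open import Data.Unit.Base using (⊤; tt)
open import Data.Vec.Base using (lookup; toList; tabulate)
import Data.Vec.Properties as Vec
import Data.Vec.Relation.Unary.All as VAll
open import Data.Vec.Relation.Unary.All.Properties using (lookup⁺; lookup⁻)
import Data.Vec.Relation.Unary.Any as VAny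
open import Data.Vec.Relation.Unary.Any.Properties using (toList⁺; toList⁻)
open import Function.Base using (_∘_)
open import Function.Bundles using (_⇔_; mk⇔)
open import Relation.Binary.Definitions using (DecidableEquality)
open import Relation.Binary.PropositionalEquality
  using (_≡_; _≢_; refl; sym; trans; cong; subst; subst₂; module ≡-Reasoning)
open import Relation.Nullary.Decidable using (Dec; yes; no; map′; decidable-stable)

p≤p+δ : ∀ p {δ} → 0ℚ ≤ δ → p ≤ p ℚ.+ δ
p≤p+δ p {δ} 0≤δ = subst (_≤ p ℚ.+ δ) (ℚ.+-identityʳ p) (ℚ.+-monoʳ-≤ p 0≤δ)

archimedean : ∀ (p : ℚ) → ∃[ c ] toℚᵘ p ℚᵘ.< + c ℚᵘ./ 1
archimedean (mkℚ z d _) =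
  suc ℤ.∣ z ∣ , ℚᵘ.*<* (subst (ℤ._< + (suc ℤ.∣ z ∣ ℕ.* suc d)) (sym (ℤ.*-identityʳ z))
                         (ℤ.≤-<-trans (z≤∣z∣ z) (ℤ.+<+ (ℕ.m≤m*n (suc ℤ.∣ z ∣) (suc d)))))
  where
  z≤∣z∣ : ∀ z → z ℤ.≤ + ℤ.∣ z ∣
  z≤∣z∣ (+ _)    = ℤ.≤-refl
  z≤∣z∣ -[1+ _ ] = ℤ.-≤+

1+c≃c+1 : ∀ c → + suc c ℚᵘ./ 1 ℚᵘ.≃ + c ℚᵘ./ 1 ℚᵘ.+ ℚᵘ.1ℚᵘ
1+c≃c+1 c = ℚᵘ.*≡* (trans (ℤ.*-identityʳ (+ suc c)) (sym (trans (ℤ.*-identityʳ _)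
              (trans (cong (ℤ._+ + 1) (ℤ.*-identityʳ (+ c))) (cong +_ (ℕ.+-comm c 1))))))

module _ {d : ℕ → ℚ} (d≥0 : ∀ t → 0ℚ ≤ d t) where

  elapsed-mono : ∀ c t → elapsed d t ≤ elapsed d (c + t)
  elapsed-mono zero    t = ℚ.≤-refl
  elapsed-mono (suc c) t = ℚ.≤-trans (elapsed-mono c t) (p≤p+δ _ (d≥0 (c + t)))

  elapsed-unbounded : (∀ t → ∃[ c ] d (c + t) ≡ 1ℚ) →
                      ∀ c → ∃[ N ] + c ℚᵘ./ 1 ℚᵘ.≤ toℚᵘ (elapsed d N)
  elapsed-unbounded ones zero    = 0 , ℚᵘ.≤-refl
  elapsed-unbounded ones (suc c) with elapsed-unbounded ones c
  ... | N , c≤ with ones N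
  ...   | c′ , d≡1 = suc (c′ + N) , (begin
    + suc c ℚᵘ./ 1                                     ≃⟨ 1+c≃c+1 c ⟩
    + c ℚᵘ./ 1 ℚᵘ.+ ℚᵘ.1ℚᵘ                             ≤⟨ ℚᵘ.+-mono-≤ c≤′ (ℚᵘ.≤-reflexive-≡ (cong toℚᵘ (sym d≡1))) ⟩
    toℚᵘ (elapsed d (c′ + N)) ℚᵘ.+ toℚᵘ (d (c′ + N))  ≃⟨ ℚ.toℚᵘ-homo-+ (elapsed d (c′ + N)) (d (c′ + N)) ⟨
    toℚᵘ (elapsed d (suc (c′ + N)))                   ∎)
    where
    open ℚᵘ.≤-Reasoning
    c≤′ : + c ℚᵘ./ 1 ℚᵘ.≤ toℚᵘ (elapsed d (c′ + N))
    c≤′ = ℚᵘ.≤-trans c≤ (ℚ.toℚᵘ-mono-≤ (elapsed-mono c′ N))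

elapsed-zero : {d : ℕ → ℚ} → (∀ t → d t ≡ 0ℚ) → ∀ N → elapsed d N ≡ 0ℚ
elapsed-zero d≡0 zero    = refl
elapsed-zero d≡0 (suc N) rewrite elapsed-zero d≡0 N | d≡0 N = refl

module _ {A : TA} (ρ : Run A) where
  open Run ρ

  unbounded⇒nonZeno : (∀ c → ∃[ N ] + c ℚᵘ./ 1 ℚᵘ.≤ toℚᵘ (elapsed delay N)) → NonZeno ρ
  unbounded⇒nonZeno grows (B , bounded) with archimedean B
  ... | c , B<c with grows c
  ...   | N , c≤ = ℚᵘ.<-irrefl ℚᵘ.≃-refl
                     (ℚᵘ.<-≤-trans B<c (ℚᵘ.≤-trans c≤ (ℚ.toℚᵘ-mono-≤ (bounded N))))

  zero-delays⇒Zeno : (∀ t → delay t ≡ 0ℚ) → Zeno ρ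
  zero-delays⇒Zeno d≡0 = 0ℚ , λ N → ℚ.≤-reflexive (elapsed-zero d≡0 N)

  val-mono : ∀ t x → x ∉ Transition.reset (step t) → val t x ≤ val (suc t) x
  val-mono t x x∉ = subst (val t x ≤_) (sym (reset-out t x x∉)) (p≤p+δ _ (delay≥0 t))

  module _ (_≟_ : DecidableEquality (TA.C A)) where
    open DecMembership _≟_ using (_∈?_)

    val-nonneg : ∀ t x → 0ℚ ≤ val t x
    val-nonneg zero    x = ℚ.≤-reflexive (sym (val₀ x))
    val-nonneg (suc t) x with x ∈? Transition.reset (step t)
    ... | yes x∈ = ℚ.≤-reflexive (sym (reset-in t x x∈))
    ... | no  x∉ = ℚ.≤-trans (val-nonneg t x) (val-mono t x x∉)

    val-pos : ∀ t x → 0ℚ < delay t → x ∉ Transition.reset (step t) → 0ℚ < val (suc t) x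
    val-pos t x δ>0 x∉ = subst (0ℚ <_) (sym (reset-out t x x∉))
      (ℚ.+-mono-≤-< (val-nonneg t x) δ>0)

module _ {C : Set} (_≟_ : DecidableEquality C) where
  open DecMembership _≟_ using (_∈?_)

  resetClocks : List C → Valuation C → Valuation C
  resetClocks R v x with x ∈? R
  ... | yes _ = 0ℚ
  ... | no  _ = v x

  resetClocks-∈ : ∀ R v {x} → x ∈ R → resetClocks R v x ≡ 0ℚ
  resetClocks-∈ R v {x} x∈ with x ∈? R
  ... | yes _  = refl
  ... | no  x∉ = ⊥-elim (x∉ x∈)

  resetClocks-∉ : ∀ R v {x} → x ∉ R → resetClocks R v x ≡ v x
  resetClocks-∉ R v {x} x∉ with x ∈? R
  ... | yes x∈ = ⊥-elim (x∉ x∈)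
  ... | no  _  = refl

module Positional (A : TA) where
  open TA A renaming (trans to transitions)

  module Play (_≟_ : DecidableEquality C)
    (move : Q → Transition Q C) (wait : Q → ℚ) (Safe : Q → Valuation C → Set)
    (move∈ : ∀ s → move s ∈ transitions)
    (src-move : ∀ s → Transition.src (move s) ≡ s)
    (wait≥0 : ∀ s → 0ℚ ≤ wait s)
    (safe₀ : Safe q₀ (λ _ → 0ℚ))
    (enabled : ∀ s {v} → Safe s v → (v ⊕ wait s) ⊨ Transition.guard (move s))
    (safe-step : ∀ s {v} → Safe s v → Safe (Transition.tgt (move s))
                                              (resetClocks _≟_ (Transition.reset (move s)) (v ⊕ wait s)))
    where

    state : ℕ → Q
    state zero    = q₀
    state (suc t) = Transition.tgt (move (state t))

    valuation : ℕ → Valuation C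
    valuation zero    _ = 0ℚ
    valuation (suc t)   =
      resetClocks _≟_ (Transition.reset (move (state t))) (valuation t ⊕ wait (state t))

    safe : ∀ t → Safe (state t) (valuation t)
    safe zero    = safe₀
    safe (suc t) = safe-step (state t) (safe t)

    run : Run A
    run = record
      { st = state ; val = valuation ; delay = wait ∘ state ; step = move ∘ state
      ; st₀ = refl ; val₀ = λ _ → refl ; delay≥0 = wait≥0 ∘ state
      ; step∈ = move∈ ∘ state ; src≡ = src-move ∘ state ; tgt≡ = λ _ → refl
      ; guard-ok = λ t → enabled (state t) (safe t)
      ; reset-in = λ t x → resetClocks-∈ _≟_ _ _
      ; reset-out = λ t x → resetClocks-∉ _≟_ _ _
      }

_≟ᶜ_ : ∀ {k} → DecidableEquality (NZClock k)
_≟ᶜ_ = ≡-dec Fin._≟_ Bool._≟_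

private variable
  k n : ℕ

NZTransition : ℕ → ℕ → Set
NZTransition k n = Transition (NZState k n) (NZClock k)

clauseCheck : Fin n → Literal k → NZTransition k n
clauseCheck m ℓ = tr (r (inject₁ m)) ((cl ℓ ∶ le ∶ 0) ∷ []) [] (r (suc m))

data NZStep (φ : Formula k n) : NZTransition k n → Set where
  assign  : (i : Fin k) (b : Bool) → NZStep φ (tr (q (inject₁ i)) [] ((i , b) ∷ []) (q (suc i)))
  check   : (m : Fin n) {ℓ : Literal k} → ℓ ∈ toList (lookup φ m) → NZStep φ (clauseCheck m ℓ)
  enter   : NZStep φ (tr (q (fromℕ k)) [] [] (r zero))
  restart : NZStep φ (tr (r (fromℕ n)) [] [] (q zero))

module _ {φ : Formula k n} where

  qSteps rSteps : List (NZTransition k n)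
  qSteps = concatMap qTrans (allFin k)
  rSteps = concatMap (rTrans φ) (allFin n)

  NZStep⇒∈ : ∀ {T} → NZStep φ T → T ∈ NZTrans φ
  NZStep⇒∈ (assign i true)  = ∈-++⁺ˡ (∈-concatMap⁺ qTrans (lose (∈-allFin i) (here refl)))
  NZStep⇒∈ (assign i false) = ∈-++⁺ˡ (∈-concatMap⁺ qTrans (lose (∈-allFin i) (there (here refl))))
  NZStep⇒∈ (check m ℓ∈) =
    ∈-++⁺ʳ qSteps (∈-++⁺ˡ (∈-concatMap⁺ (rTrans φ) (lose (∈-allFin m) (∈-map⁺ (clauseCheck m) ℓ∈))))
  NZStep⇒∈ enter   = ∈-++⁺ʳ qSteps (∈-++⁺ʳ rSteps (here refl))
  NZStep⇒∈ restart = ∈-++⁺ʳ qSteps (∈-++⁺ʳ rSteps (there (here refl)))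

  ∈⇒NZStep : ∀ {T} → T ∈ NZTrans φ → NZStep φ T
  ∈⇒NZStep T∈ with ∈-++⁻ qSteps T∈
  ... | inj₁ T∈q with satisfied (∈-concatMap⁻ qTrans {xs = allFin k} T∈q)
  ...   | i , here refl         = assign i true
  ...   | i , there (here refl) = assign i false
  ∈⇒NZStep T∈ | inj₂ T∈rest with ∈-++⁻ rSteps T∈rest
  ... | inj₁ T∈r with satisfied (∈-concatMap⁻ (rTrans φ) {xs = allFin n} T∈r)
  ...   | m , T∈m with ∈-map⁻ (clauseCheck m) T∈m
  ...     | ℓ , ℓ∈ , refl = check m ℓ∈
  ∈⇒NZStep T∈ | inj₂ T∈rest | inj₂ (here refl)         = enter
  ∈⇒NZStep T∈ | inj₂ T∈rest | inj₂ (there (here refl)) = restart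

r-injective : ∀ {f g : Fin (suc n)} → r {k} f ≡ r g → f ≡ g
r-injective refl = refl

-- The number of steps from a state to r₀ along the cycle q₀ ⋯ q_k r₀ ⋯ r_n q₀.
dist-r₀ : NZState k n → ℕ
dist-r₀ {k}     (q p)       = suc (k ∸ toℕ p)
dist-r₀         (r zero)    = 0
dist-r₀ {k} {n} (r (suc m)) = suc (suc ((n ∸ suc (toℕ m)) + k))

dist-r₀≡0 : ∀ (s : NZState k n) → dist-r₀ s ≡ 0 → s ≡ r zero
dist-r₀≡0 (r zero) _ = refl

dist-r₀≡suc⇒≢r₀ : ∀ {s : NZState k n} {d} → dist-r₀ s ≡ suc d → s ≢ r zero
dist-r₀≡suc⇒≢r₀ () refl

m∸i≡1+m∸1+i : ∀ {m} (i : Fin m) → m ∸ toℕ i ≡ suc (m ∸ suc (toℕ i))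
m∸i≡1+m∸1+i i = ℕ.+-∸-assoc 1 (Fin.toℕ<n i)

dist-r₀-step : ∀ {φ : Formula k n} {T} → NZStep φ T → Transition.src T ≢ r zero →
               suc (dist-r₀ (Transition.tgt T)) ≡ dist-r₀ (Transition.src T)
dist-r₀-step {k} (assign i b) _ =
  cong suc (sym (trans (cong (k ∸_) (Fin.toℕ-inject₁ i)) (m∸i≡1+m∸1+i i)))
dist-r₀-step         (check zero _)    src≢r₀ = ⊥-elim (src≢r₀ refl)
dist-r₀-step {k} {n} (check (suc m) _) _      = cong (λ d → suc (suc (d + k)))
  (sym (trans (cong (λ j → n ∸ suc j) (Fin.toℕ-inject₁ m)) (m∸i≡1+m∸1+i (suc m))))
dist-r₀-step {k} enter _ = cong suc (sym (trans (cong (k ∸_) (Fin.toℕ-fromℕ k)) (ℕ.n∸n≡0 k)))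
dist-r₀-step {n = zero}  restart src≢r₀ = ⊥-elim (src≢r₀ refl)
dist-r₀-step {k} {suc n} restart _      =
  cong (λ d → suc (suc (d + k))) (sym (trans (cong (n ∸_) (Fin.toℕ-fromℕ n)) (ℕ.n∸n≡0 n)))

step-from-clause : ∀ {φ : Formula k n} {T m} → NZStep φ T → Transition.src T ≡ r (inject₁ m) →
                   ∃[ ℓ ] ℓ ∈ toList (lookup φ m) × T ≡ clauseCheck m ℓ
step-from-clause (check m′ ℓ∈) src≡ with Fin.inject₁-injective (r-injective src≡)
... | refl = _ , ℓ∈ , refl
step-from-clause restart src≡ = ⊥-elim (Fin.fromℕ≢inject₁ (r-injective src≡))

-- From a non-Zeno run to a satisfying assignment

-- Unset s i: between s and the next visit of r₀, one clock of variable i gets reset.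
Unset : NZState k n → Fin k → Set
Unset (q p)       i = toℕ p ℕ.≤ toℕ i
Unset (r zero)    i = ⊥
Unset (r (suc _)) i = ⊤

unset-r : ∀ {f : Fin (suc n)} {i : Fin k} → r {k} f ≢ r zero → Unset (r f) i
unset-r {f = zero}  f≢0 = ⊥-elim (f≢0 refl)
unset-r {f = suc _} _   = tt

record VarInvariant (s : NZState k n) (v : Valuation (NZClock k)) (i : Fin k) : Set where
  constructor var-invariant
  field
    witness      : Bool
    witness-pos  : 0ℚ < v (i , witness)
    unset⇒pos    : Unset s i → ∀ b → 0ℚ < v (i , b)

ClockInvariant : NZState k n → Valuation (NZClock k) → Set
ClockInvariant s v = ∀ i → VarInvariant s v i

other-var∉ : ∀ {i j : Fin k} {b c : Bool} → j ≢ i → (j , c) ∉ (i , b) ∷ []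
other-var∉ j≢i (here same) = j≢i (cong proj₁ same)

other-value∉ : ∀ {i : Fin k} b → (i , not b) ∉ (i , b) ∷ []
other-value∉ b (here same) = Bool.not-¬ refl (sym (cong proj₂ same))

invariant-untouched : ∀ {s s′ : NZState k n} {v v′ R i} →
                      (∀ x → x ∉ R → v x ≤ v′ x) → (∀ b → (i , b) ∉ R) →
                      (Unset s′ i → Unset s i) → VarInvariant s v i → VarInvariant s′ v′ i
invariant-untouched v≤v′ untouched unset (var-invariant b pos unset⇒pos) =
  var-invariant b (ℚ.<-≤-trans pos (v≤v′ _ (untouched b)))
  λ u b′ → ℚ.<-≤-trans (unset⇒pos (unset u) b′) (v≤v′ _ (untouched b′))

invariant-step : ∀ {φ : Formula k n} {T v v′} → NZStep φ T → Transition.src T ≢ r zero →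
                 (∀ x → x ∉ Transition.reset T → v x ≤ v′ x) →
                 ClockInvariant (Transition.src T) v → ClockInvariant (Transition.tgt T) v′
invariant-step (assign i b) _ v≤v′ inv j with j Fin.≟ i
... | yes refl =
  var-invariant (not b)
    (ℚ.<-≤-trans (VarInvariant.unset⇒pos (inv i) (ℕ.≤-reflexive (Fin.toℕ-inject₁ i)) (not b))
                 (v≤v′ _ (other-value∉ b)))
    λ i<i → ⊥-elim (ℕ.<-irrefl refl i<i)
... | no j≢i = invariant-untouched v≤v′ (λ _ → other-var∉ j≢i)
  (λ i<j → subst (ℕ._≤ toℕ j) (sym (Fin.toℕ-inject₁ i)) (ℕ.<⇒≤ i<j)) (inv j)
invariant-step (check _ _) src≢r₀ v≤v′ inv j =
  invariant-untouched v≤v′ (λ _ ()) (λ _ → unset-r src≢r₀) (inv j)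
invariant-step enter       _      v≤v′ inv j =
  invariant-untouched v≤v′ (λ _ ()) ⊥-elim (inv j)
invariant-step restart     src≢r₀ v≤v′ inv j =
  invariant-untouched v≤v′ (λ _ ()) (λ _ → unset-r src≢r₀) (inv j)

invariant-start : ∀ {φ : Formula k n} {T v} → NZStep φ T →
                  (∀ x → x ∉ Transition.reset T → 0ℚ < v x) → ClockInvariant (Transition.tgt T) v
invariant-start (assign i b) pos j with j Fin.≟ i
... | yes refl = var-invariant (not b) (pos _ (other-value∉ b)) λ i<i → ⊥-elim (ℕ.<-irrefl refl i<i)
... | no j≢i   = var-invariant b (pos _ (other-var∉ j≢i)) λ _ _ → pos _ (other-var∉ j≢i)
invariant-start (check _ _) pos j = var-invariant true (pos _ λ ()) λ _ _ → pos _ λ ()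
invariant-start enter       pos j = var-invariant true (pos _ λ ()) λ _ _ → pos _ λ ()
invariant-start restart     pos j = var-invariant true (pos _ λ ()) λ _ _ → pos _ λ ()

module NZRun {k n : ℕ} {φ : Formula k n} (ρ : Run (A-NZ φ)) where
  open Run ρ

  kind : ∀ t → NZStep φ (step t)
  kind t = ∈⇒NZStep (step∈ t)

  src≢r₀ : ∀ {t} → st t ≢ r zero → Transition.src (step t) ≢ r zero
  src≢r₀ {t} st≢r₀ src≡r₀ = st≢r₀ (trans (sym (src≡ t)) src≡r₀)

  dist-r₀-suc : ∀ {t} → st t ≢ r zero → suc (dist-r₀ (st (suc t))) ≡ dist-r₀ (st t)
  dist-r₀-suc {t} st≢r₀ = subst₂ (λ s s′ → suc (dist-r₀ s′) ≡ dist-r₀ s) (src≡ t) (tgt≡ t)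
                            (dist-r₀-step (kind t) (src≢r₀ st≢r₀))

  reach-r₀ : (P : ℕ → Set) → (∀ {t} → st t ≢ r zero → P t → P (suc t)) →
             ∀ t → P t → ∃[ c ] st (c + t) ≡ r zero × P (c + t)
  reach-r₀ P P-suc t = go (dist-r₀ (st t)) t refl
    where
    go : ∀ d t → dist-r₀ (st t) ≡ d → P t → ∃[ c ] st (c + t) ≡ r zero × P (c + t)
    go zero    t d≡0 Pt = 0 , dist-r₀≡0 (st t) d≡0 , Pt
    go (suc d) t d≡  Pt
      with go d (suc t) (ℕ.suc-injective (trans (dist-r₀-suc (dist-r₀≡suc⇒≢r₀ d≡)) d≡))
              (P-suc (dist-r₀≡suc⇒≢r₀ d≡) Pt)
    ... | c , at , Pu rewrite ℕ.+-suc c t = suc c , at , Pu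

  clause-step : ∀ {u m} → st u ≡ r (inject₁ m) →
                ∃[ ℓ ] ℓ ∈ toList (lookup φ m) × step u ≡ clauseCheck m ℓ
  clause-step {u} st≡ = step-from-clause (kind u) (trans (src≡ u) st≡)

  r-walk : ∀ {t} → st t ≡ r zero → ∀ f → st (toℕ f + t) ≡ r f × (∀ x → val t x ≤ val (toℕ f + t) x)
  r-walk {t} st≡r₀ = <-weakInduction P (st≡r₀ , λ _ → ℚ.≤-refl) P-suc
    where
    P : Fin (suc n) → Set
    P f = st (toℕ f + t) ≡ r f × (∀ x → val t x ≤ val (toℕ f + t) x)
    P-suc : ∀ m → P (inject₁ m) → P (suc m)
    P-suc m (at , grown) rewrite Fin.toℕ-inject₁ m with clause-step at
    ... | ℓ , _ , step≡ =
      trans (sym (tgt≡ _)) (cong Transition.tgt step≡) ,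
      λ x → ℚ.≤-trans (grown x)
              (val-mono ρ _ x (¬Any[] ∘ subst (x ∈_) (cong Transition.reset step≡)))

  clause-guard : ∀ {u m ℓ} → step u ≡ clauseCheck m ℓ → val u (cl ℓ) ℚ.+ delay u ≤ 0ℚ
  clause-guard {u} step≡
    with subst (λ T → (val u ⊕ delay u) ⊨ Transition.guard T) step≡ (guard-ok u)
  ... | guard ∷ [] = guard

  checked-literal : ∀ {t} → st t ≡ r zero → ∀ m →
                    ∃[ ℓ ] ℓ ∈ toList (lookup φ m) × val t (cl ℓ) ≤ 0ℚ
  checked-literal st≡r₀ m with r-walk st≡r₀ (inject₁ m)
  ... | at , grown with clause-step at
  ...   | ℓ , ℓ∈ , step≡ =
    ℓ , ℓ∈ , ℚ.≤-trans (grown (cl ℓ)) (ℚ.≤-trans (p≤p+δ _ (delay≥0 _)) (clause-guard step≡))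

Satisfies : ∀ {k n} → Assignment k → Formula k n → Set
Satisfies a φ = VAll.All (VAny.Any (litTrue a)) φ

satisfiable? : ∀ {k n} (φ : Formula k n) → Dec (Satisfiable φ)
satisfiable? φ = map′ (λ (v , sat) → lookup v , sat)
                      (λ (a , sat) → tabulate a , respects a sat)
                      (anySubset? (λ v → satisfies? (lookup v)))
  where
  satisfies? : ∀ a → Dec (Satisfies a φ)
  satisfies? a = VAll.all? (VAny.any? (λ (i , b) → a i Bool.≟ b)) φ
  respects : ∀ a → Satisfies a φ → Satisfies (lookup (tabulate a)) φ
  respects a = VAll.map (VAny.map (λ {(i , _)} → trans (Vec.lookup∘tabulate a i)))

module Soundness {k n : ℕ} {φ : Formula k n} (ρ : Run (A-NZ φ)) where
  open Run ρ
  open NZRun {φ = φ} ρ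

  invariant-after-delay : ∀ j → 0ℚ < delay j → ClockInvariant (st (suc j)) (val (suc j))
  invariant-after-delay j δ>0 = subst (λ s → ClockInvariant s (val (suc j))) (tgt≡ j)
    (invariant-start (kind j) (λ x → val-pos ρ _≟ᶜ_ j x δ>0))

  invariant-suc : ∀ {t} → st t ≢ r zero →
                  ClockInvariant (st t) (val t) → ClockInvariant (st (suc t)) (val (suc t))
  invariant-suc {t} st≢r₀ inv = subst (λ s → ClockInvariant s (val (suc t))) (tgt≡ t)
    (invariant-step (kind t) (src≢r₀ st≢r₀) (val-mono ρ t)
       (subst (λ s → ClockInvariant s (val t)) (sym (src≡ t)) inv))

  -- Set each variable opposite to a positive clock of it; then the checked literals, whose clocks
  -- read 0, are true.
  satisfiable-at-r₀ : ∀ {t} → st t ≡ r zero → ClockInvariant (st t) (val t) → Satisfiable φ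
  satisfiable-at-r₀ {t} st≡r₀ inv = a , lookup⁻ clause-true
    where
    a : Assignment k
    a i = not (VarInvariant.witness (inv i))
    true-if-zero : ∀ {i b} → val t (i , b) ≤ 0ℚ → litTrue a (i , b)
    true-if-zero {i} ≤0 = sym (Bool.¬-not λ { refl →
      ℚ.<-irrefl refl (ℚ.<-≤-trans (VarInvariant.witness-pos (inv i)) ≤0) })
    clause-true : ∀ m → VAny.Any (litTrue a) (lookup φ m)
    clause-true m with checked-literal st≡r₀ m
    ... | ℓ , ℓ∈ , ≤0 = toList⁻ (lose ℓ∈ (true-if-zero ≤0))

  positive-delay⇒satisfiable : ∀ j → 0ℚ < delay j → Satisfiable φ
  positive-delay⇒satisfiable j δ>0
    with reach-r₀ (λ t → ClockInvariant (st t) (val t)) invariant-suc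
                  (suc j) (invariant-after-delay j δ>0)
  ... | _ , st≡r₀ , inv = satisfiable-at-r₀ st≡r₀ inv

  nonZeno⇒satisfiable : NonZeno ρ → Satisfiable φ
  nonZeno⇒satisfiable nonZeno = decidable-stable (satisfiable? φ) λ unsat →
    nonZeno (zero-delays⇒Zeno ρ λ t →
      ℚ.≤-antisym (ℚ.≮⇒≥ (unsat ∘ positive-delay⇒satisfiable t)) (delay≥0 t))

-- From a satisfying assignment to a non-Zeno run

data Position {k n} : NZState k n → Set where
  assigning  : (i : Fin k) → Position (q (inject₁ i))
  entering   : Position (q (fromℕ k))
  checking   : (m : Fin n) → Position (r (inject₁ m))
  restarting : Position (r (fromℕ n))

q-position : {p : Fin (suc k)} → View p → Position {n = n} (q p)
q-position ‵fromℕ       = entering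
q-position (‵inject₁ i) = assigning i

r-position : {f : Fin (suc n)} → View f → Position {k} (r f)
r-position ‵fromℕ       = restarting
r-position (‵inject₁ m) = checking m

position : (s : NZState k n) → Position s
position (q p) = q-position (view p)
position (r f) = r-position (view f)

position-restarting : position (r {k} (fromℕ n)) ≡ restarting
position-restarting {n = n} rewrite view-fromℕ n = refl

module Completeness {k n : ℕ} {φ : Formula k n} (a : Assignment k) (sat : Satisfies a φ) where

  true-literal : (m : Fin n) → ∃[ ℓ ] ℓ ∈ toList (lookup φ m) × litTrue a ℓ
  true-literal m = find (toList⁺ (lookup⁺ sat m))

  move : {s : NZState k n} → Position s → NZTransition k n
  move (assigning i) = tr (q (inject₁ i)) [] ((i , a i) ∷ []) (q (suc i))
  move entering      = tr (q (fromℕ k)) [] [] (r zero)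
  move (checking m)  = clauseCheck m (proj₁ (true-literal m))
  move restarting    = tr (r (fromℕ n)) [] [] (q zero)

  move-step : {s : NZState k n} (p : Position s) → NZStep φ (move p)
  move-step (assigning i) = assign i (a i)
  move-step entering      = enter
  move-step (checking m)  = check m (proj₁ (proj₂ (true-literal m)))
  move-step restarting    = restart

  move-src : {s : NZState k n} (p : Position s) → Transition.src (move p) ≡ s
  move-src (assigning i) = refl
  move-src entering      = refl
  move-src (checking m)  = refl
  move-src restarting    = refl

  wait : {s : NZState k n} → Position s → ℚ
  wait restarting    = 1ℚ
  wait (assigning _) = 0ℚ
  wait entering      = 0ℚ
  wait (checking _)  = 0ℚ

  wait≥0 : {s : NZState k n} (p : Position s) → 0ℚ ≤ wait p
  wait≥0 restarting    = ℚ.<⇒≤ (ℚ.positive⁻¹ 1ℚ)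
  wait≥0 (assigning _) = ℚ.≤-refl
  wait≥0 entering      = ℚ.≤-refl
  wait≥0 (checking _)  = ℚ.≤-refl

  -- The clock (i , a i) of the literal made true by a reads 0 from its reset at q_i until the
  -- run restarts.
  Agrees : NZState k n → Valuation (NZClock k) → Set
  Agrees (q p) v = ∀ i → toℕ i ℕ.< toℕ p → v (i , a i) ≡ 0ℚ
  Agrees (r _) v = ∀ i → v (i , a i) ≡ 0ℚ

  enabled : ∀ {s} (p : Position s) {v} → Agrees s v → (v ⊕ wait p) ⊨ Transition.guard (move p)
  enabled (checking m) agrees with true-literal m
  ... | (i , _) , _ , refl = ℚ.≤-reflexive (trans (ℚ.+-identityʳ _) (agrees i)) ∷ []
  enabled (assigning _) _ = []
  enabled entering      _ = []
  enabled restarting    _ = []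

  unchanged : ∀ (R : List (NZClock k)) v {x} → x ∉ R → resetClocks _≟ᶜ_ R (v ⊕ 0ℚ) x ≡ v x
  unchanged R v {x} x∉ = trans (resetClocks-∉ _≟ᶜ_ R (v ⊕ 0ℚ) x∉) (ℚ.+-identityʳ (v x))

  agrees-step : ∀ {s} (p : Position s) {v} → Agrees s v →
                Agrees (Transition.tgt (move p))
                       (resetClocks _≟ᶜ_ (Transition.reset (move p)) (v ⊕ wait p))
  agrees-step (assigning i) {v} agrees j j≤i = by-cases (j Fin.≟ i)
    where
    R = (i , a i) ∷ []
    by-cases : Dec (j ≡ i) → resetClocks _≟ᶜ_ R (v ⊕ 0ℚ) (j , a j) ≡ 0ℚ
    by-cases (yes refl) = resetClocks-∈ _≟ᶜ_ R (v ⊕ 0ℚ) (here refl)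
    by-cases (no j≢i)   = trans (unchanged R v (other-var∉ j≢i)) (agrees j j<i)
      where
      j<i : toℕ j ℕ.< toℕ (inject₁ i)
      j<i = subst (toℕ j ℕ.<_) (sym (Fin.toℕ-inject₁ i))
              (ℕ.≤∧≢⇒< (ℕ.s≤s⁻¹ j≤i) (j≢i ∘ Fin.toℕ-injective))
  agrees-step entering agrees i =
    trans (ℚ.+-identityʳ _) (agrees i (subst (toℕ i ℕ.<_) (sym (Fin.toℕ-fromℕ k)) (Fin.toℕ<n i)))
  agrees-step (checking m) agrees i = trans (ℚ.+-identityʳ _) (agrees i)
  agrees-step restarting   agrees i ()

  agrees-initially : Agrees (q zero) (λ _ → 0ℚ)
  agrees-initially _ ()

  module Strategy = Positional.Play (A-NZ φ) _≟ᶜ_ (move ∘ position) (wait ∘ position) Agrees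
    (NZStep⇒∈ ∘ move-step ∘ position) (move-src ∘ position) (wait≥0 ∘ position)
    agrees-initially (enabled ∘ position) (agrees-step ∘ position)

  open Strategy public using (state; run)

  module RunFacts = NZRun {φ = φ} run

  restarts-infinitely-often : ∀ t → ∃[ c ] Run.delay run (c + t) ≡ 1ℚ
  restarts-infinitely-often t with RunFacts.reach-r₀ (λ _ → ⊤) (λ _ _ → tt) t tt
  ... | c , st≡r₀ , _ = n + c , (begin
    wait (position (state (n + c + t)))    ≡⟨ cong (wait ∘ position ∘ state) (ℕ.+-assoc n c t) ⟩
    wait (position (state (n + (c + t))))  ≡⟨ cong (wait ∘ position) at-rₙ ⟩
    wait (position (r (fromℕ n)))          ≡⟨ cong wait position-restarting ⟩
    1ℚ                                     ∎)
    where
    open ≡-Reasoning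
    at-rₙ : state (n + (c + t)) ≡ r (fromℕ n)
    at-rₙ = subst (λ j → state (j + (c + t)) ≡ r (fromℕ n)) (Fin.toℕ-fromℕ n)
              (proj₁ (RunFacts.r-walk st≡r₀ (fromℕ n)))

  nonZeno : NonZeno run
  nonZeno = unbounded⇒nonZeno run (elapsed-unbounded (Run.delay≥0 run) restarts-infinitely-often)

lemma2p1 : ∀ (k n : ℕ) (φ : Formula k n) →
    Satisfiable φ ⇔ Σ (Run (A-NZ φ)) NonZeno
lemma2p1 k n φ = mk⇔
  (λ (a , sat) → Completeness.run a sat , Completeness.nonZeno a sat)
  (λ (ρ , nonZeno) → Soundness.nonZeno⇒satisfiable ρ nonZeno)
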